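{- Let $n\ge1$ and $x\in\mathrm{Asc}(n)$, and let $A=\Gamma^{ -1}(x)\in\mathrm{Int}(n)$. Then all diagonal entries of $A$ are positive if and only if $x$ is self-modified, i.e. $\hat x=x$.
   Context: $\mathrm{Int}(n)$ is the set of upper triangular square matrices with non-negative integer entries summing to $n$ such that every row and column has a non-zero entry. For such $A$: $\dim(A)$ is the number of rows, $\mathrm{index}(A)$ the smallest $i$ with $A_{i,\dim(A)}>0$, $\mathrm{val}(A)=A_{\mathrm{index}(A),\dim(A)}$. For a sequence $y$, $\mathrm{asc}(y)$ is the number of $i$ with $y_i<y_{i+1}$; $\mathrm{Asc}(n)$ is the set of integer sequences $(x_1,\dots,x_n)$ with $x_1=0$ and $x_i\in[0,1+\mathrm{asc}(x_1,\dots,x_{i-1})]$ for $1<i\le n$. Removal operation $f$ on $A\in\mathrm{Int}(n)$, $n\ge2$: (Rem1) if $\mathrm{val}(A)>1$, or if $\mathrm{val}(A)=1$, $\mathrm{index}(A)<\dim(A)$ and row $\mathrm{index}(A)$ has another positive entry, decrease entry $(\mathrm{index}(A),\dim(A))$ by $1$; (Rem2) if $\mathrm{val}(A)=1$ and $\mathrm{index}(A)=\dim(A)$, delete last row and column; (Rem3) if $\mathrm{val}(A)=1$, $\mathrm{index}(A)<\dim(A)$ and all other entries of row $\mathrm{index}(A)$ are $0$, set $A_{i,\dim(A)}:=A_{i,\mathrm{index}(A)}$ for $1\le i\le\mathrm{index}(A)-1$, then delete row and column $\mathrm{index}(A)$. $\Gamma:\mathrm{Int}(n)\to\mathrm{Asc}(n)$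 is a bijection defined by $\Gamma((1))=(0)$ and, for $n\ge2$, $\Gamma(A)$ is $\Gamma(f(A))$ with $\mathrm{index}(A)-1$ appended. Modified ascent sequence $\hat x$: with $\mathfrak{asc}(x)=\{i\in[n-1]:x_i<x_{i+1}\}$, process $i\in\mathfrak{asc}(x)$ in increasing order and for each $j\in[i-1]$ with $x_j\ge x_{i+1}$ (current values) replace $x_j$ by $x_j+1$. -}

module Defs where

open import Data.Nat using (ℕ; zero; suc; _+_; _∸_; _≤_; _<_; _<ᵇ_; _≡ᵇ_)
open import Data.Bool using (Bool; true; false; if_then_else_; _∧_; _∨_; not)
open import Data.Fin using (Fin; toℕ; fromℕ; inject₁; punchIn; _≟_)
open import Data.List using (List; []; _∷_; _++_; [_]; length; take; lookup; head; foldl; upTo)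
open import Data.Maybe using (Maybe; just; nothing)
open import Data.Product using (∃; _×_)
open import Relation.Nullary using (does)
open import Relation.Binary.PropositionalEquality using (_≡_)

record Mat : Set where
  constructor mat
  field
    dim   : ℕ
    entry : Fin dim → Fin dim → ℕ
open Mat public

sumFin : (d : ℕ) → (Fin d → ℕ) → ℕ
sumFin zero    f = 0
sumFin (suc d) f = f Fin.zero + sumFin d (λ i → f (Fin.suc i))

record InInt (n : ℕ) (A : Mat) : Set where
  field
    upper  : ∀ i j → toℕ j < toℕ i → entry A i j ≡ 0
    total  : sumFin (dim A) (λ i → sumFin (dim A) (λ j → entry A i j)) ≡ n
    rowPos : ∀ i → ∃ λ j → 0 < entry A i j
    colPos : ∀ j → ∃ λ i → 0 < entry A i j

firstPos : (d : ℕ) → (Fin d → ℕ) → Maybe (Fin d)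
firstPos zero    v = nothing
firstPos (suc d) v with 0 <ᵇ v Fin.zero
... | true  = just Fin.zero
... | false with firstPos d (λ i → v (Fin.suc i))
...   | just k  = just (Fin.suc k)
...   | nothing = nothing

anyFin : (d : ℕ) → (Fin d → Bool) → Bool
anyFin zero    p = false
anyFin (suc d) p = p Fin.zero ∨ anyFin d (λ i → p (Fin.suc i))

-- index(A) - 1 (i.e. the 0-based index), when dim A ≥ 1 and the last column
-- has a positive entry
index0 : Mat → Maybe ℕ
index0 (mat zero e)    = nothing
index0 (mat (suc d) e) with firstPos (suc d) (λ i → e i (fromℕ d))
... | just k  = just (toℕ k)
... | nothing = nothing

decr : ∀ {d} → Fin d → Fin d → (Fin d → Fin d → ℕ) → (Fin d → Fin d → ℕ)
decr k c e i j = if does (i ≟ k) ∧ does (j ≟ c) then e i j ∸ 1 else e i j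

removal : Mat → Mat
removal (mat zero e) = mat zero e
removal (mat (suc d) e) with firstPos (suc d) (λ i → e i (fromℕ d))
... | nothing = mat (suc d) e
... | just k with 1 <ᵇ e k (fromℕ d)
...   | true  = mat (suc d) (decr k (fromℕ d) e)                    -- Rem1 (val > 1)
...   | false with toℕ k ≡ᵇ d
...     | true  = mat d (λ i j → e (inject₁ i) (inject₁ j))          -- Rem2
...     | false with anyFin (suc d) (λ j → not (does (j ≟ fromℕ d)) ∧ (0 <ᵇ e k j))
...       | true  = mat (suc d) (decr k (fromℕ d) e)                  -- Rem1 (val = 1)
...       | false = mat d (λ i j → e' (punchIn k i) (punchIn k j))    -- Rem3
  where
  e' : Fin (suc d) → Fin (suc d) → ℕ
  e' i j = if does (j ≟ fromℕ d) ∧ (toℕ i <ᵇ toℕ k) then e i k else e i j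

-- the appended value index(A) - 1 (0 in the degenerate case, which never
-- occurs for A ∈ Int(n))
lastVal : Maybe ℕ → ℕ
lastVal (just i) = i
lastVal nothing  = 0

Γ : ℕ → Mat → List ℕ
Γ zero          A = []
Γ (suc zero)    A = 0 ∷ []
Γ (suc (suc n)) A = Γ (suc n) (removal A) ++ [ lastVal (index0 A) ]

asc : List ℕ → ℕ
asc []           = 0
asc (a ∷ [])     = 0
asc (a ∷ b ∷ t)  = (if a <ᵇ b then 1 else 0) + asc (b ∷ t)

-- x ∈ Asc(n)  (positions 0-based: position i here is x_{i+1} in the paper)
record InAsc (n : ℕ) (x : List ℕ) : Set where
  field
    len   : length x ≡ n
    first : head x ≡ just 0
    bound : (i : Fin (length x)) → 0 < toℕ i →
            lookup x i ≤ suc (asc (take (toℕ i) x))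

nth : List ℕ → ℕ → ℕ
nth []      _       = 0
nth (a ∷ _) zero    = a
nth (_ ∷ t) (suc k) = nth t k

bump : ℕ → ℕ → List ℕ → List ℕ
bump t zero    ys      = ys
bump t (suc m) []      = []
bump t (suc m) (y ∷ ys) = (if not (y <ᵇ t) then suc y else y) ∷ bump t m ys

hat : List ℕ → List ℕ
hat x = foldl step x (upTo (length x ∸ 1))
  where
  step : List ℕ → ℕ → List ℕ
  step y p = if nth x p <ᵇ nth x (suc p) then bump (nth x (suc p)) p y else y

-- Γ(A) is Γ(f(A)) followed by index(A) − 1, so we induct along the removal operation, carrying
-- three facts about x = Γ(A): its entries are below dim(A); if the diagonal of A is positive, one
-- of them equals dim(A) − 1; and the diagonal of A is positive iff every ascent x_p < x_{p+1}
-- exceeds all of x_1, …, x_{p−1}. Rem1 and Rem2 preserve whether the diagonal is positive, and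
-- the appended value either is no ascent (Rem1 never moves the first positive entry of the last
-- column up) or exceeds every earlier entry (Rem2 appends dim(A) − 1). In Rem3 the entry
-- A_{index(A),index(A)} is 0, and the appended value is an ascent that does not exceed the entry
-- dim(f(A)) − 1 present whenever f(A) has positive diagonal. Finally, building x̂ only ever
-- increases entries, so x̂ = x iff each of its steps fixes x, which is that ascent condition.

module Submission where

open import Defs
open import Data.Bool using (Bool; true; false; T; if_then_else_; not; _∧_)
open import Data.Fin using (Fin; toℕ; fromℕ; inject₁; punchIn; punchOut; _≟_)
open import Data.Fin.Properties
  using (toℕ-injective; toℕ-fromℕ; toℕ<n; toℕ-inject₁; ≤fromℕ; fromℕ≢inject₁;
         punchIn-injective; punchInᵢ≢i; punchIn-mono-≤; punchIn-punchOut)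
open import Data.Fin.Relation.Unary.Top using (view; ‵fromℕ; ‵inject₁)
open import Data.List using (List; []; _∷_; _++_; [_]; length; foldl; applyUpTo)
open import Data.List.Properties using (length-++; ∷-injectiveˡ; ∷-injectiveʳ)
open import Data.List.Relation.Binary.Pointwise as Pointwise using (Pointwise; []; _∷_; Pointwise-≡⇒≡)
open import Data.List.Relation.Unary.All using (All; []; _∷_)
open import Data.List.Relation.Unary.All.Properties using (applyUpTo⁺₁; applyUpTo⁻)
open import Data.Maybe using (just; nothing)
open import Data.Nat using (ℕ; zero; suc; _+_; _∸_; _≤_; _<_; z≤n; s≤s; z<s; s≤s⁻¹; _<ᵇ_; _≡ᵇ_; _<?_)
open import Data.Nat.Properties hiding (_≟_)
open import Data.Product using (_×_; _,_; proj₁; proj₂; ∃)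
open import Data.Sum using (inj₁; inj₂)
open import Data.Unit using (tt)
open import Function using (_∘_; case_of_)
open import Function.Bundles using (_⇔_; mk⇔; Equivalence)
open import Function.Properties.Equivalence using () renaming (trans to ⇔-trans; sym to ⇔-sym)
open import Relation.Binary using (Rel; IsPartialOrder)
open import Relation.Binary.PropositionalEquality hiding ([_]; J)
open import Relation.Nullary using (¬_; Dec; yes; no; does; contradiction)
open import Relation.Nullary.Reflects using (Reflects; ofʸ; ofⁿ; fromEquivalence)

open import Algebra.Properties.CommutativeSemigroup +-commutativeSemigroup using (x∙yz≈y∙xz; xy∙z≈zy∙x)

open Equivalence using (to; from)

≡ᵇ-reflects-≡ : ∀ m n → Reflects (m ≡ n) (m ≡ᵇ n)
≡ᵇ-reflects-≡ m n = fromEquivalence (≡ᵇ⇒≡ m n) (≡⇒≡ᵇ m n)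

-- Finite sums

sumFin-cong : ∀ d {f g : Fin d → ℕ} → (∀ i → f i ≡ g i) → sumFin d f ≡ sumFin d g
sumFin-cong zero    f≗g = refl
sumFin-cong (suc d) f≗g = cong₂ _+_ (f≗g Fin.zero) (sumFin-cong d (f≗g ∘ Fin.suc))

sumFin-zero : ∀ d {f : Fin d → ℕ} → (∀ i → f i ≡ 0) → sumFin d f ≡ 0
sumFin-zero zero    f≗0 = refl
sumFin-zero (suc d) f≗0 = cong₂ _+_ (f≗0 Fin.zero) (sumFin-zero d (f≗0 ∘ Fin.suc))

≤-sumFin : ∀ d (f : Fin d → ℕ) i → f i ≤ sumFin d f
≤-sumFin (suc d) f Fin.zero    = m≤m+n _ _
≤-sumFin (suc d) f (Fin.suc i) = ≤-trans (≤-sumFin d (f ∘ Fin.suc) i) (m≤n+m _ _)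

size≤sumFin : ∀ d (f : Fin d → ℕ) → (∀ i → 0 < f i) → d ≤ sumFin d f
size≤sumFin zero    f pos = z≤n
size≤sumFin (suc d) f pos = +-mono-≤ (pos Fin.zero) (size≤sumFin d (f ∘ Fin.suc) (pos ∘ Fin.suc))

sumFin-punchIn : ∀ d (f : Fin (suc d) → ℕ) k → sumFin (suc d) f ≡ f k + sumFin d (f ∘ punchIn k)
sumFin-punchIn d       f Fin.zero    = refl
sumFin-punchIn (suc d) f (Fin.suc k) = begin
  f₀ + sumFin (suc d) (f ∘ Fin.suc)              ≡⟨ cong (f₀ +_) (sumFin-punchIn d (f ∘ Fin.suc) k) ⟩
  f₀ + (f (Fin.suc k) + rest)                    ≡⟨ x∙yz≈y∙xz f₀ (f (Fin.suc k)) rest ⟩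
  f (Fin.suc k) + (f₀ + rest)                    ∎
  where
  open ≡-Reasoning
  f₀ rest : ℕ
  f₀ = f Fin.zero
  rest = sumFin d (f ∘ Fin.suc ∘ punchIn k)

sumFin-last : ∀ d (f : Fin (suc d) → ℕ) → sumFin (suc d) f ≡ sumFin d (f ∘ inject₁) + f (fromℕ d)
sumFin-last zero    f = +-identityʳ _
sumFin-last (suc d) f = trans (cong (f Fin.zero +_) (sumFin-last d (f ∘ Fin.suc))) (sym (+-assoc (f Fin.zero) _ _))

sumFin-exchange : ∀ d (f g : Fin (suc d) → ℕ) j → (∀ i → i ≢ j → f i ≡ g i) →
                  sumFin (suc d) f + g j ≡ sumFin (suc d) g + f j
sumFin-exchange d f g j agree = begin
  sumFin (suc d) f + g j                      ≡⟨ cong (_+ g j) (sumFin-punchIn d f j) ⟩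
  f j + sumFin d (f ∘ punchIn j) + g j        ≡⟨ cong (λ s → f j + s + g j) (sumFin-cong d agree′) ⟩
  f j + sumFin d (g ∘ punchIn j) + g j        ≡⟨ xy∙z≈zy∙x (f j) _ (g j) ⟩
  g j + sumFin d (g ∘ punchIn j) + f j        ≡⟨ cong (_+ f j) (sumFin-punchIn d g j) ⟨
  sumFin (suc d) g + f j                      ∎
  where
  open ≡-Reasoning
  agree′ : ∀ i → f (punchIn j i) ≡ g (punchIn j i)
  agree′ i = agree (punchIn j i) (punchInᵢ≢i j i)

sumFin-suc-at : ∀ d (f g : Fin (suc d) → ℕ) j → f j ≡ suc (g j) → (∀ i → i ≢ j → f i ≡ g i) →
                sumFin (suc d) f ≡ suc (sumFin (suc d) g)
sumFin-suc-at d f g j fj agree = +-cancelʳ-≡ (g j) _ _ (begin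
  sumFin (suc d) f + g j         ≡⟨ sumFin-exchange d f g j agree ⟩
  sumFin (suc d) g + f j         ≡⟨ cong (sumFin (suc d) g +_) fj ⟩
  sumFin (suc d) g + suc (g j)   ≡⟨ +-suc _ _ ⟩
  suc (sumFin (suc d) g) + g j   ∎)
  where open ≡-Reasoning

-- Modified ascent sequences

module _ {a ℓ} {A B : Set a} {_⊑_ : Rel A ℓ} (⊑-po : IsPartialOrder _≡_ _⊑_)
         (g : A → B → A) (inflationary : ∀ y p → y ⊑ g y p) where

  open IsPartialOrder ⊑-po using () renaming (trans to ⊑-trans; antisym to ⊑-antisym)

  private
    foldl-fixed⇒ : ∀ {x} y ps → x ⊑ y → foldl g y ps ≡ x → y ≡ x × All (λ p → g x p ≡ x) ps
    foldl-fixed⇒ y []       x⊑y fold≡x = fold≡x , []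
    foldl-fixed⇒ y (p ∷ ps) x⊑y fold≡x with foldl-fixed⇒ (g y p) ps (⊑-trans x⊑y (inflationary y p)) fold≡x
    ... | gyp≡x , fixes = y≡x , subst (λ z → g z p ≡ _) y≡x gyp≡x ∷ fixes
      where
      y≡x : y ≡ _
      y≡x = ⊑-antisym (subst (y ⊑_) gyp≡x (inflationary y p)) x⊑y

    foldl-fixed⇐ : ∀ x ps → All (λ p → g x p ≡ x) ps → foldl g x ps ≡ x
    foldl-fixed⇐ x []       []             = refl
    foldl-fixed⇐ x (p ∷ ps) (gxp≡x ∷ fixes) rewrite gxp≡x = foldl-fixed⇐ x ps fixes

  foldl-inflationary-fixed : ∀ x ps → foldl g x ps ≡ x ⇔ All (λ p → g x p ≡ x) ps
  foldl-inflationary-fixed x ps =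
    mk⇔ (proj₂ ∘ foldl-fixed⇒ x ps (IsPartialOrder.refl ⊑-po)) (foldl-fixed⇐ x ps)

pointwise-≤-isPartialOrder : IsPartialOrder _≡_ (Pointwise _≤_)
pointwise-≤-isPartialOrder = record
  { isPreorder = record
    { isEquivalence = isEquivalence
    ; reflexive     = λ { refl → Pointwise.refl ≤-refl }
    ; trans         = Pointwise.transitive ≤-trans
    }
  ; antisym = λ xs≤ys ys≤xs → Pointwise-≡⇒≡ (Pointwise.antisymmetric ≤-antisym xs≤ys ys≤xs)
  }

bump-inflationary : ∀ t m y → Pointwise _≤_ y (bump t m y)
bump-inflationary t zero    y        = Pointwise.refl ≤-refl
bump-inflationary t (suc m) []       = []
bump-inflationary t (suc m) (y ∷ ys) with y <ᵇ t
... | true  = ≤-refl   ∷ bump-inflationary t m ys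
... | false = n≤1+n y ∷ bump-inflationary t m ys

bump-fixed : ∀ t m y → bump t m y ≡ y ⇔ (∀ q → q < m → q < length y → nth y q < t)
bump-fixed t m y = mk⇔ (⇒ m y) (⇐ m y)
  where
  ⇒ : ∀ m y → bump t m y ≡ y → ∀ q → q < m → q < length y → nth y q < t
  ⇒ (suc m) (y ∷ ys) fixed zero    _         _ with y <ᵇ t | <ᵇ-reflects-< y t
  ... | true  | ofʸ y<t = y<t
  ... | false | _       = contradiction (∷-injectiveˡ fixed) 1+n≢n
  ⇒ (suc m) (y ∷ ys) fixed (suc q) (s≤s q<m) (s≤s q<len) =
    ⇒ m ys (∷-injectiveʳ fixed) q q<m q<len

  ⇐ : ∀ m y → (∀ q → q < m → q < length y → nth y q < t) → bump t m y ≡ y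
  ⇐ zero    y        below = refl
  ⇐ (suc m) []       below = refl
  ⇐ (suc m) (y ∷ ys) below with y <ᵇ t | <ᵇ-reflects-< y t
  ... | true  | _       = cong (y ∷_) (⇐ m ys (λ q q<m q<len → below (suc q) (s≤s q<m) (s≤s q<len)))
  ... | false | ofⁿ y≮t = contradiction (below zero z<s z<s) y≮t

AscentDominates : List ℕ → ℕ → ℕ → Set
AscentDominates x p t = nth x p < t → ∀ q → q < p → nth x q < t

AscentsDominate : ℕ → List ℕ → Set
AscentsDominate n x = ∀ p → p < n → AscentDominates x p (nth x (suc p))

hatStep : List ℕ → List ℕ → ℕ → List ℕ
hatStep x y p = if nth x p <ᵇ nth x (suc p) then bump (nth x (suc p)) p y else y

hatStep-inflationary : ∀ x y p → Pointwise _≤_ y (hatStep x y p)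
hatStep-inflationary x y p with nth x p <ᵇ nth x (suc p)
... | true  = bump-inflationary _ p y
... | false = Pointwise.refl ≤-refl

hatStep-fixed : ∀ x p → p < length x → hatStep x x p ≡ x ⇔ AscentDominates x p (nth x (suc p))
hatStep-fixed x p p<len with nth x p <ᵇ nth x (suc p) | <ᵇ-reflects-< (nth x p) (nth x (suc p))
... | true  | ofʸ ascent = mk⇔
  (λ fixed _ q q<p → to (bump-fixed _ p x) fixed q q<p (<-trans q<p p<len))
  (λ dominates → from (bump-fixed _ p x) (λ q q<p _ → dominates ascent q q<p))
... | false | ofⁿ noAscent = mk⇔ (λ _ ascent → contradiction ascent noAscent) (λ _ → refl)

hat-fixed : ∀ x → hat x ≡ x ⇔ AscentsDominate (length x ∸ 1) x
hat-fixed x = mk⇔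
  (λ fixed p p<m → to (hatStep-fixed x p (p<len p<m))
     (applyUpTo⁻ (λ i → i) m (to fold-fixed fixed) p<m))
  (λ dominate → from fold-fixed
     (applyUpTo⁺₁ (λ i → i) m (λ p<m → from (hatStep-fixed x _ (p<len p<m)) (dominate _ p<m))))
  where
  m : ℕ
  m = length x ∸ 1
  fold-fixed : hat x ≡ x ⇔ All (λ p → hatStep x x p ≡ x) (applyUpTo (λ i → i) m)
  fold-fixed = foldl-inflationary-fixed pointwise-≤-isPartialOrder (hatStep x) (hatStep-inflationary x)
                                        x (applyUpTo (λ i → i) m)
  p<len : ∀ {p} → p < m → p < length x
  p<len p<m = <-≤-trans p<m (m∸n≤m (length x) 1)

nth-++-< : ∀ xs k i → i < length xs → nth (xs ++ [ k ]) i ≡ nth xs i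
nth-++-< (x ∷ xs) k zero    _          = refl
nth-++-< (x ∷ xs) k (suc i) (s≤s i<len) = nth-++-< xs k i i<len

nth-++-length : ∀ xs k → nth (xs ++ [ k ]) (length xs) ≡ k
nth-++-length []       k = refl
nth-++-length (x ∷ xs) k = nth-++-length xs k

AscentDominates-cong : ∀ x y p t → (∀ i → i ≤ p → nth x i ≡ nth y i) →
                       AscentDominates x p t → AscentDominates y p t
AscentDominates-cong x y p t x≗y dominates ascent q q<p =
  subst (_< t) (x≗y q (<⇒≤ q<p)) (dominates (subst (_< t) (sym (x≗y p ≤-refl)) ascent) q q<p)

AscentsDominate-snoc : ∀ m xs k → length xs ≡ suc m →
  AscentsDominate (suc m) (xs ++ [ k ]) ⇔ (AscentsDominate m xs × AscentDominates xs m k)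
AscentsDominate-snoc m xs k len = mk⇔
  (λ dominate → (λ p p<m → old⇒ p<m (dominate p (m<n⇒m<1+n p<m))) , new⇒ (dominate m ≤-refl))
  (λ { (dominate , dominatesNew) p p<1+m → case m≤n⇒m<n∨m≡n (s≤s⁻¹ p<1+m) of λ
       { (inj₁ p<m)  → old⇐ p<m (dominate p p<m)
       ; (inj₂ refl) → new⇐ dominatesNew } })
  where
  ys : List ℕ
  ys = xs ++ [ k ]
  agree : ∀ {i} → i < suc m → nth ys i ≡ nth xs i
  agree {i} i<1+m = nth-++-< xs k i (subst (i <_) (sym len) i<1+m)
  agree-upTo : ∀ {p} → p < suc m → ∀ i → i ≤ p → nth ys i ≡ nth xs i
  agree-upTo p<1+m i i≤p = agree (≤-<-trans i≤p p<1+m)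
  new : nth ys (suc m) ≡ k
  new = subst (λ j → nth ys j ≡ k) len (nth-++-length xs k)

  old⇒ : ∀ {p} → p < m → AscentDominates ys p (nth ys (suc p)) → AscentDominates xs p (nth xs (suc p))
  old⇒ {p} p<m = AscentDominates-cong ys xs p _ (agree-upTo (m<n⇒m<1+n p<m))
               ∘ subst (AscentDominates ys p) (agree (s≤s p<m))
  old⇐ : ∀ {p} → p < m → AscentDominates xs p (nth xs (suc p)) → AscentDominates ys p (nth ys (suc p))
  old⇐ {p} p<m = subst (AscentDominates ys p) (sym (agree (s≤s p<m)))
               ∘ AscentDominates-cong xs ys p _ (λ i → sym ∘ agree-upTo (m<n⇒m<1+n p<m) i)
  new⇒ : AscentDominates ys m (nth ys (suc m)) → AscentDominates xs m k
  new⇒ = AscentDominates-cong ys xs m k (agree-upTo ≤-refl) ∘ subst (AscentDominates ys m) new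
  new⇐ : AscentDominates xs m k → AscentDominates ys m (nth ys (suc m))
  new⇐ = subst (AscentDominates ys m) (sym new) ∘ AscentDominates-cong xs ys m k (λ i → sym ∘ agree-upTo ≤-refl i)

-- Matrices in Int(n)

PosDiag : Mat → Set
PosDiag A = ∀ i → 0 < entry A i i

inject₁<fromℕ : ∀ {d} (j : Fin d) → toℕ (inject₁ j) < toℕ (fromℕ d)
inject₁<fromℕ j = ≤∧≢⇒< (≤fromℕ (inject₁ j)) (fromℕ≢inject₁ ∘ sym ∘ toℕ-injective)

lastDiagonal-pos : ∀ {n d e} → InInt n (mat (suc d) e) → 0 < e (fromℕ d) (fromℕ d)
lastDiagonal-pos {d = d} A∈ with InInt.rowPos A∈ (fromℕ d)
... | j , pos with view j
...   | ‵fromℕ      = pos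
...   | ‵inject₁ j′ =
  contradiction (InInt.upper A∈ (fromℕ d) (inject₁ j′) (inject₁<fromℕ j′)) (n>0⇒n≢0 pos)

dim≤total : ∀ {n A} → InInt n A → dim A ≤ n
dim≤total {A = mat d e} A∈ = subst (d ≤_) (InInt.total A∈) (size≤sumFin d _ rowSum-pos)
  where
  rowSum-pos : ∀ i → 0 < sumFin d (e i)
  rowSum-pos i = let (j , pos) = InInt.rowPos A∈ i in <-≤-trans pos (≤-sumFin d (e i) j)

firstPos-just : ∀ d (v : Fin d → ℕ) {k} → firstPos d v ≡ just k →
                0 < v k × (∀ i → toℕ i < toℕ k → v i ≡ 0)
firstPos-just (suc d) v found with 0 <ᵇ v Fin.zero | <ᵇ-reflects-< 0 (v Fin.zero)
firstPos-just (suc d) v refl | true  | ofʸ pos = pos , λ i ()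
... | false | ofⁿ ¬pos with firstPos d (v ∘ Fin.suc) in found′
firstPos-just (suc d) v refl | false | ofⁿ ¬pos | just k with firstPos-just d (v ∘ Fin.suc) found′
... | pos , before = pos , λ { Fin.zero _ → n≤0⇒n≡0 (≮⇒≥ ¬pos) ; (Fin.suc i) (s≤s i<k) → before i i<k }
firstPos-just (suc d) v ()   | false | ofⁿ ¬pos | nothing

firstPos-nothing : ∀ d (v : Fin d → ℕ) → firstPos d v ≡ nothing → ∀ i → v i ≡ 0
firstPos-nothing (suc d) v none i with 0 <ᵇ v Fin.zero | <ᵇ-reflects-< 0 (v Fin.zero)
firstPos-nothing (suc d) v () i | true | _
... | false | ofⁿ ¬pos with firstPos d (v ∘ Fin.suc) in none′
firstPos-nothing (suc d) v () i           | false | ofⁿ ¬pos | just _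
firstPos-nothing (suc d) v _  Fin.zero    | false | ofⁿ ¬pos | nothing = n≤0⇒n≡0 (≮⇒≥ ¬pos)
firstPos-nothing (suc d) v _  (Fin.suc i) | false | ofⁿ ¬pos | nothing = firstPos-nothing d (v ∘ Fin.suc) none′ i

anyFin-reflects : ∀ d (p : Fin d → Bool) → Reflects (∃ λ j → T (p j)) (anyFin d p)
anyFin-reflects zero    p = ofⁿ λ ()
anyFin-reflects (suc d) p with p Fin.zero in p₀
... | true = ofʸ (Fin.zero , subst T (sym p₀) tt)
... | false with anyFin d (p ∘ Fin.suc) | anyFin-reflects d (p ∘ Fin.suc)
...   | true  | ofʸ (j , pj) = ofʸ (Fin.suc j , pj)
...   | false | ofⁿ none     = ofⁿ λ { (Fin.zero , pz) → subst T p₀ pz ; (Fin.suc j , pj) → none (j , pj) }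

index0-just : ∀ {n} A → InInt (suc n) A → ∃ λ l → index0 A ≡ just l
index0-just (mat zero e) A∈ with InInt.total A∈
... | ()
index0-just (mat (suc d) e) A∈ with firstPos (suc d) (λ i → e i (fromℕ d)) in none
... | just k  = toℕ k , refl
... | nothing = contradiction (firstPos-nothing (suc d) (λ i → e i (fromℕ d)) none (fromℕ d))
                              (n>0⇒n≢0 (lastDiagonal-pos A∈))

index0-≤ : ∀ d (e : Fin (suc d) → Fin (suc d) → ℕ) {l} → index0 (mat (suc d) e) ≡ just l →
           ∀ i → 0 < e i (fromℕ d) → l ≤ toℕ i
index0-≤ d e found i pos with firstPos (suc d) (λ i → e i (fromℕ d)) in found′
index0-≤ d e refl i pos | just k with toℕ i <? toℕ k
... | yes i<k = contradiction (proj₂ (firstPos-just (suc d) (λ i → e i (fromℕ d)) found′) i i<k) (n>0⇒n≢0 pos)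
... | no  i≮k = ≮⇒≥ i≮k
index0-≤ d e () i pos | nothing

index0-pos : ∀ d (e : Fin (suc d) → Fin (suc d) → ℕ) {l} → index0 (mat (suc d) e) ≡ just l →
             ∃ λ i → toℕ i ≡ l × 0 < e i (fromℕ d)
index0-pos d e found with firstPos (suc d) (λ i → e i (fromℕ d)) in found′
index0-pos d e refl | just k  = k , refl , proj₁ (firstPos-just (suc d) (λ i → e i (fromℕ d)) found′)
index0-pos d e ()   | nothing

-- Rem1

module _ {d} (k c : Fin (suc d)) (e : Fin (suc d) → Fin (suc d) → ℕ) where

  decr-≢ : ∀ i j → ¬ (i ≡ k × j ≡ c) → decr k c e i j ≡ e i j
  decr-≢ i j ≢kc with i ≟ k | j ≟ c
  ... | yes i≡k | yes j≡c = contradiction (i≡k , j≡c) ≢kc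
  ... | yes _   | no  _   = refl
  ... | no  _   | _       = refl

  decr-≡ : decr k c e k c ≡ e k c ∸ 1
  decr-≡ with k ≟ k | c ≟ c
  ... | yes _ | yes _ = refl
  ... | no  k≢k | _     = contradiction refl k≢k
  ... | yes _ | no  c≢c = contradiction refl c≢c

  decr-≤ : ∀ i j → decr k c e i j ≤ e i j
  decr-≤ i j with does (i ≟ k) ∧ does (j ≟ c)
  ... | true  = m∸n≤m _ 1
  ... | false = ≤-refl

  decr-InInt : ∀ {n} → InInt (suc n) (mat (suc d) e) → 0 < e k c →
               (∃ λ j → 0 < decr k c e k j) → (∃ λ i → 0 < decr k c e i c) → InInt n (mat (suc d) (decr k c e))
  decr-InInt A∈ pos rowk colc = record
    { upper  = λ i j j<i → n≤0⇒n≡0 (subst (decr k c e i j ≤_) (InInt.upper A∈ i j j<i) (decr-≤ i j))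
    ; total  = suc-injective (trans (sym total-drops) (InInt.total A∈))
    ; rowPos = rowPos
    ; colPos = colPos
    }
    where
    rowk-drops : sumFin (suc d) (e k) ≡ suc (sumFin (suc d) (decr k c e k))
    rowk-drops = sumFin-suc-at d (e k) (decr k c e k) c
                   (trans (sym (trans (+-comm 1 _) (m∸n+n≡m pos))) (cong suc (sym decr-≡)))
                   (λ j j≢c → sym (decr-≢ k j (j≢c ∘ proj₂)))
    total-drops : sumFin (suc d) (λ i → sumFin (suc d) (e i)) ≡
                  suc (sumFin (suc d) (λ i → sumFin (suc d) (decr k c e i)))
    total-drops = sumFin-suc-at d (λ i → sumFin (suc d) (e i)) (λ i → sumFin (suc d) (decr k c e i)) k rowk-drops
                    (λ i i≢k → sumFin-cong (suc d) (λ j → sym (decr-≢ i j (i≢k ∘ proj₁))))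
    rowPos : ∀ i → ∃ λ j → 0 < decr k c e i j
    rowPos i = case i ≟ k of λ
      { (yes refl) → rowk
      ; (no i≢k)   → let (j , pos) = InInt.rowPos A∈ i in
                      j , subst (0 <_) (sym (decr-≢ i j (i≢k ∘ proj₁))) pos }
    colPos : ∀ j → ∃ λ i → 0 < decr k c e i j
    colPos j = case j ≟ c of λ
      { (yes refl) → colc
      ; (no j≢c)   → let (i , pos) = InInt.colPos A∈ j in
                      i , subst (0 <_) (sym (decr-≢ i j (j≢c ∘ proj₂))) pos }

  decr-PosDiag : (k ≡ c → 1 < e k c) → PosDiag (mat (suc d) e) ⇔ PosDiag (mat (suc d) (decr k c e))
  decr-PosDiag big =
    mk⇔ (λ diag i → still-pos diag i (i ≟ k) (i ≟ c)) (λ diag i → ≤-trans (diag i) (decr-≤ i i))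
    where
    still-pos : PosDiag (mat (suc d) e) → ∀ i → Dec (i ≡ k) → Dec (i ≡ c) → 0 < decr k c e i i
    still-pos diag i (yes refl) (yes refl) = subst (0 <_) (sym decr-≡) (∸-monoˡ-≤ 1 (big refl))
    still-pos diag i (yes _)    (no  i≢c)  = subst (0 <_) (sym (decr-≢ i i (i≢c ∘ proj₂))) (diag i)
    still-pos diag i (no  i≢k)  _          = subst (0 <_) (sym (decr-≢ i i (i≢k ∘ proj₁))) (diag i)

decr-index0-≥ : ∀ d e (k : Fin (suc d)) → (∀ i → toℕ i < toℕ k → e i (fromℕ d) ≡ 0) →
                ∀ {l} → index0 (mat (suc d) (decr k (fromℕ d) e)) ≡ just l → toℕ k ≤ l
decr-index0-≥ d e k above found with index0-pos d (decr k (fromℕ d) e) found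
... | i , refl , pos with toℕ i <? toℕ k
...   | yes i<k = contradiction (above i i<k) (n>0⇒n≢0 (≤-trans pos (decr-≤ k (fromℕ d) e i (fromℕ d))))
...   | no  i≮k = ≮⇒≥ i≮k

-- Rem2

withoutLast : ∀ {d} → (Fin (suc d) → Fin (suc d) → ℕ) → Mat
withoutLast {d} e = mat d (λ i j → e (inject₁ i) (inject₁ j))

module _ {n d} {e : Fin (suc d) → Fin (suc d) → ℕ} (A∈ : InInt (suc (suc n)) (mat (suc d) e))
         (lastEntry : e (fromℕ d) (fromℕ d) ≡ 1) (aboveLast : ∀ i → e (inject₁ i) (fromℕ d) ≡ 0) where

  private
    B : Mat
    B = withoutLast e

  dropLast-InInt : InInt (suc n) (withoutLast e)
  dropLast-InInt = record
    { upper  = λ i j j<i → InInt.upper A∈ (inject₁ i) (inject₁ j)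
                             (subst₂ _<_ (sym (toℕ-inject₁ j)) (sym (toℕ-inject₁ i)) j<i)
    ; total  = suc-injective (trans (trans (+-comm 1 _) (sym total-drops)) (InInt.total A∈))
    ; rowPos = rowPos
    ; colPos = colPos
    }
    where
    belowLast : ∀ j → e (fromℕ d) (inject₁ j) ≡ 0
    belowLast j = InInt.upper A∈ (fromℕ d) (inject₁ j) (inject₁<fromℕ j)
    row-inject₁ : ∀ i → sumFin (suc d) (e (inject₁ i)) ≡ sumFin d (entry B i)
    row-inject₁ i = trans (sumFin-last d (e (inject₁ i)))
                      (trans (cong (sumFin d (entry B i) +_) (aboveLast i)) (+-identityʳ _))
    row-last : sumFin (suc d) (e (fromℕ d)) ≡ 1
    row-last = trans (sumFin-last d (e (fromℕ d)))
                 (cong₂ _+_ (sumFin-zero d (λ j → belowLast j)) lastEntry)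
    total-drops : sumFin (suc d) (λ i → sumFin (suc d) (e i)) ≡ sumFin d (λ i → sumFin d (entry B i)) + 1
    total-drops = trans (sumFin-last d (λ i → sumFin (suc d) (e i))) (cong₂ _+_ (sumFin-cong d row-inject₁) row-last)
    rowPos : ∀ i → ∃ λ j → 0 < entry B i j
    rowPos i with InInt.rowPos A∈ (inject₁ i)
    ... | j , pos with view j
    ...   | ‵fromℕ      = contradiction (aboveLast i) (n>0⇒n≢0 pos)
    ...   | ‵inject₁ j′ = j′ , pos
    colPos : ∀ j → ∃ λ i → 0 < entry B i j
    colPos j with InInt.colPos A∈ (inject₁ j)
    ... | i , pos with view i
    ...   | ‵fromℕ      = contradiction (belowLast j) (n>0⇒n≢0 pos)
    ...   | ‵inject₁ i′ = i′ , pos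

  dropLast-PosDiag : PosDiag (mat (suc d) e) ⇔ PosDiag (withoutLast e)
  dropLast-PosDiag = mk⇔ (λ diag → diag ∘ inject₁) pos
    where
    pos : PosDiag B → PosDiag (mat (suc d) e)
    pos diag i with view i
    ... | ‵fromℕ      = subst (0 <_) (sym lastEntry) z<s
    ... | ‵inject₁ i′ = diag i′

-- Rem3

punchIn-fromℕ : ∀ {d} (k : Fin (suc (suc d))) → k ≢ fromℕ (suc d) → punchIn k (fromℕ d) ≡ fromℕ (suc d)
punchIn-fromℕ         Fin.zero              _   = refl
punchIn-fromℕ {zero}  (Fin.suc Fin.zero)    k≢ = contradiction refl k≢
punchIn-fromℕ {suc d} (Fin.suc k)           k≢ = cong Fin.suc (punchIn-fromℕ k (k≢ ∘ cong Fin.suc))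

toℕ-≤-punchIn : ∀ {d} (k : Fin (suc d)) j → toℕ j ≤ toℕ (punchIn k j)
toℕ-≤-punchIn Fin.zero    j           = n≤1+n _
toℕ-≤-punchIn (Fin.suc k) Fin.zero    = z≤n
toℕ-≤-punchIn (Fin.suc k) (Fin.suc j) = s≤s (toℕ-≤-punchIn k j)

punchIn-mono-< : ∀ {d} (k : Fin (suc d)) i j → toℕ j < toℕ i → toℕ (punchIn k j) < toℕ (punchIn k i)
punchIn-mono-< k i j j<i = ≤∧≢⇒< (punchIn-mono-≤ k j i (<⇒≤ j<i))
  (<⇒≢ j<i ∘ cong toℕ ∘ punchIn-injective k j i ∘ toℕ-injective)

-- Written as in the Rem3 branch of removal, so that removal A reduces to contracted e k.
copyColumnToLast : ∀ {d} → (Fin (suc d) → Fin (suc d) → ℕ) → Fin (suc d) → Fin (suc d) → Fin (suc d) → ℕ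
copyColumnToLast {d} e k i j = if does (j ≟ fromℕ d) ∧ (toℕ i <ᵇ toℕ k) then e i k else e i j

contracted : ∀ {d} → (Fin (suc d) → Fin (suc d) → ℕ) → Fin (suc d) → Mat
contracted {d} e k = mat d (λ i j → copyColumnToLast e k (punchIn k i) (punchIn k j))

module _ {n d} {e : Fin (suc (suc d)) → Fin (suc (suc d)) → ℕ} {k : Fin (suc (suc d))}
         (A∈ : InInt (suc (suc n)) (mat (suc (suc d)) e))
         (valOne : e k (fromℕ (suc d)) ≡ 1) (k≢last : k ≢ fromℕ (suc d))
         (rowOnlyLast : ∀ j → j ≢ fromℕ (suc d) → e k j ≡ 0)
         (firstInLast : ∀ i → toℕ i < toℕ k → e i (fromℕ (suc d)) ≡ 0) where

  private
    last : Fin (suc (suc d))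
    last = fromℕ (suc d)

    E′ : Fin (suc (suc d)) → Fin (suc (suc d)) → ℕ
    E′ = copyColumnToLast e k

    B : Mat
    B = contracted e k

    E′-moved : ∀ i {j} → j ≡ last → toℕ i < toℕ k → E′ i j ≡ e i k
    E′-moved i {j} j≡last i<k with j ≟ last | toℕ i <ᵇ toℕ k | <ᵇ-reflects-< (toℕ i) (toℕ k)
    ... | yes _ | true  | _       = refl
    ... | yes _ | false | ofⁿ i≮k = contradiction i<k i≮k
    ... | no j≢ | _     | _       = contradiction j≡last j≢

    E′-kept : ∀ i j → ¬ (j ≡ last × toℕ i < toℕ k) → E′ i j ≡ e i j
    E′-kept i j moved with j ≟ last | toℕ i <ᵇ toℕ k | <ᵇ-reflects-< (toℕ i) (toℕ k)
    ... | yes j≡last | true  | ofʸ i<k = contradiction (j≡last , i<k) moved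
    ... | yes _      | false | _        = refl
    ... | no  _      | _     | _        = refl

    punchIn-last : punchIn k (fromℕ d) ≡ last
    punchIn-last = punchIn-fromℕ k k≢last

    diagonal-k : e k k ≡ 0
    diagonal-k = rowOnlyLast k k≢last

    above-k : ∀ i → 0 < e i k → toℕ i < toℕ k
    above-k i pos = ≤∧≢⇒< (≮⇒≥ (n>0⇒n≢0 pos ∘ InInt.upper A∈ i k))
                          (λ i≡k → n>0⇒n≢0 pos (trans (cong (λ z → e z k) (toℕ-injective i≡k)) diagonal-k))

    lastColumn-pos : ∃ λ i′ → toℕ i′ < toℕ k × 0 < entry B i′ (fromℕ d)
    lastColumn-pos with InInt.colPos A∈ k
    ... | i , pos = i′ , i′<k , subst (0 <_) (sym moved) pos
      where
      i≢k : i ≢ k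
      i≢k i≡k = n>0⇒n≢0 pos (trans (cong (λ z → e z k) i≡k) diagonal-k)
      i′ : Fin (suc d)
      i′ = punchOut (i≢k ∘ sym)
      I≡i : punchIn k i′ ≡ i
      I≡i = punchIn-punchOut (i≢k ∘ sym)
      i′<k : toℕ i′ < toℕ k
      i′<k = ≤-<-trans (toℕ-≤-punchIn k i′) (subst (λ z → toℕ z < toℕ k) (sym I≡i) (above-k i pos))
      moved : entry B i′ (fromℕ d) ≡ e i k
      moved = trans (cong₂ E′ I≡i punchIn-last) (E′-moved i refl (above-k i pos))

    row-E′ : ∀ i → i ≢ k → sumFin (suc (suc d)) (E′ i) ≡ sumFin (suc (suc d)) (e i) + e i k
    row-E′ i i≢k with toℕ i <? toℕ k
    ... | yes i<k = +-cancelʳ-≡ (e i last) _ _ (begin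
      sumFin (suc (suc d)) (E′ i) + e i last       ≡⟨ sumFin-exchange (suc d) (E′ i) (e i) last
                                                         (λ j j≢last → E′-kept i j (j≢last ∘ proj₁)) ⟩
      sumFin (suc (suc d)) (e i) + E′ i last       ≡⟨ cong (_ +_) (E′-moved i refl i<k) ⟩
      sumFin (suc (suc d)) (e i) + e i k           ≡⟨ +-identityʳ _ ⟨
      sumFin (suc (suc d)) (e i) + e i k + 0
        ≡⟨ cong (sumFin (suc (suc d)) (e i) + e i k +_) (firstInLast i i<k) ⟨
      sumFin (suc (suc d)) (e i) + e i k + e i last ∎)
      where open ≡-Reasoning
    ... | no  i≮k = trans (sumFin-cong (suc (suc d)) (λ j → E′-kept i j (i≮k ∘ proj₂)))
                      (sym (trans (cong (sumFin (suc (suc d)) (e i) +_) (InInt.upper A∈ i k k<i)) (+-identityʳ _)))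
      where
      k<i : toℕ k < toℕ i
      k<i = ≤∧≢⇒< (≮⇒≥ i≮k) (i≢k ∘ toℕ-injective ∘ sym)

    row-B : ∀ i′ → sumFin (suc d) (entry B i′) ≡ sumFin (suc (suc d)) (e (punchIn k i′))
    row-B i′ = +-cancelˡ-≡ (e I k) _ _ (begin
      e I k + sumFin (suc d) (entry B i′)
        ≡⟨ cong (_+ sumFin (suc d) (entry B i′)) (E′-kept I k (k≢last ∘ proj₁)) ⟨
      E′ I k + sumFin (suc d) (E′ I ∘ punchIn k)   ≡⟨ sumFin-punchIn (suc d) (E′ I) k ⟨
      sumFin (suc (suc d)) (E′ I)                  ≡⟨ row-E′ I (punchInᵢ≢i k i′) ⟩
      sumFin (suc (suc d)) (e I) + e I k           ≡⟨ +-comm _ (e I k) ⟩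
      e I k + sumFin (suc (suc d)) (e I)           ∎)
      where
      open ≡-Reasoning
      I : Fin (suc (suc d))
      I = punchIn k i′

    row-k : sumFin (suc (suc d)) (e k) ≡ 1
    row-k = trans (sumFin-punchIn (suc d) (e k) last)
              (cong₂ _+_ valOne (sumFin-zero (suc d) (λ j → rowOnlyLast (punchIn last j) (punchInᵢ≢i last j))))

  contract-InInt : InInt (suc n) (contracted e k)
  contract-InInt = record
    { upper  = upper
    ; total  = suc-injective (trans (sym total-drops) (InInt.total A∈))
    ; rowPos = rowPos
    ; colPos = colPos
    }
    where
    upper : ∀ i j → toℕ j < toℕ i → entry B i j ≡ 0
    upper i j j<i = trans (E′-kept I J (J≢last ∘ proj₁)) (InInt.upper A∈ I J J<I)
      where
      I J : Fin (suc (suc d))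
      I = punchIn k i
      J = punchIn k j
      J<I : toℕ J < toℕ I
      J<I = punchIn-mono-< k i j j<i
      J≢last : J ≢ last
      J≢last = <⇒≢ (<-≤-trans J<I (≤fromℕ I)) ∘ cong toℕ

    total-drops : sumFin (suc (suc d)) (λ i → sumFin (suc (suc d)) (e i)) ≡
                  suc (sumFin (suc d) (λ i → sumFin (suc d) (entry B i)))
    total-drops = trans (sumFin-punchIn (suc d) (λ i → sumFin (suc (suc d)) (e i)) k)
                    (cong₂ _+_ row-k (sumFin-cong (suc d) (sym ∘ row-B)))

    rowPos : ∀ i′ → ∃ λ j → 0 < entry B i′ j
    rowPos i′ with InInt.rowPos A∈ (punchIn k i′)
    ... | j , pos with j ≟ k
    ...   | yes refl = fromℕ d , subst (0 <_) (sym moved) pos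
      where
      moved : entry B i′ (fromℕ d) ≡ e (punchIn k i′) j
      moved = trans (cong (E′ (punchIn k i′)) punchIn-last)
                    (E′-moved (punchIn k i′) refl (above-k (punchIn k i′) pos))
    ...   | no  j≢k  = punchOut (j≢k ∘ sym) , subst (0 <_) (sym kept) pos
      where
      kept : entry B i′ (punchOut (j≢k ∘ sym)) ≡ e (punchIn k i′) j
      kept = trans (cong (E′ (punchIn k i′)) (punchIn-punchOut (j≢k ∘ sym)))
                   (E′-kept (punchIn k i′) j λ { (refl , I<k) → n>0⇒n≢0 pos (firstInLast (punchIn k i′) I<k) })

    colPos′ : ∀ j′ → Dec (punchIn k j′ ≡ last) → ∃ λ i → 0 < entry B i j′
    colPos′ j′ (yes J≡last) =
      let (i′ , _ , pos) = lastColumn-pos in i′ , subst (λ z → 0 < entry B i′ z) (sym j′≡) pos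
      where
      j′≡ : j′ ≡ fromℕ d
      j′≡ = punchIn-injective k j′ (fromℕ d) (trans J≡last (sym punchIn-last))
    colPos′ j′ (no J≢last) with InInt.colPos A∈ (punchIn k j′)
    ... | i , pos = punchOut (i≢k ∘ sym) , subst (0 <_) (sym kept) pos
      where
      i≢k : i ≢ k
      i≢k i≡k = n>0⇒n≢0 pos (trans (cong (λ z → e z (punchIn k j′)) i≡k) (rowOnlyLast _ J≢last))
      kept : entry B (punchOut (i≢k ∘ sym)) j′ ≡ e i (punchIn k j′)
      kept = trans (cong (λ z → E′ z (punchIn k j′)) (punchIn-punchOut (i≢k ∘ sym)))
                   (E′-kept i _ (J≢last ∘ proj₁))

    colPos : ∀ j′ → ∃ λ i → 0 < entry B i j′
    colPos j′ = colPos′ j′ (punchIn k j′ ≟ last)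

  contract-¬PosDiag : ¬ PosDiag (mat (suc (suc d)) e)
  contract-¬PosDiag diag = n>0⇒n≢0 (diag k) diagonal-k

  contract-index0-< : ∀ {l} → index0 (contracted e k) ≡ just l → l < toℕ k
  contract-index0-< found = let (i′ , i′<k , pos) = lastColumn-pos in
    ≤-<-trans (index0-≤ d (entry B) found i′ pos) i′<k

-- B = f(A) arises by Rem1, Rem2 or Rem3 respectively, and k = index(A) − 1.
data RemovalStep (A : Mat) (k : ℕ) (B : Mat) : Set where
  decrement : PosDiag A ⇔ PosDiag B → dim B ≡ dim A → k < dim B →
              (∀ {l} → index0 B ≡ just l → k ≤ l) → RemovalStep A k B
  dropLast  : PosDiag A ⇔ PosDiag B → suc (dim B) ≡ dim A → k ≡ dim B → RemovalStep A k B
  contract  : ¬ PosDiag A → suc (dim B) ≡ dim A → k < dim B →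
              (∀ {l} → index0 B ≡ just l → l < k) → RemovalStep A k B

T-≢∧0< : ∀ {d} (j c : Fin d) v → T (not (does (j ≟ c)) ∧ (0 <ᵇ v)) ⇔ (j ≢ c × 0 < v)
T-≢∧0< j c v with j ≟ c
... | yes j≡c = mk⇔ (λ ()) (λ (j≢c , _) → contradiction j≡c j≢c)
... | no  j≢c = mk⇔ (λ t → j≢c , <ᵇ⇒< 0 v t) (<⇒<ᵇ ∘ proj₂)

contract-step : ∀ {n d e} (k : Fin (suc d)) → InInt (suc (suc n)) (mat (suc d) e) →
                e k (fromℕ d) ≡ 1 → toℕ k ≢ d → (∀ j → j ≢ fromℕ d → e k j ≡ 0) →
                (∀ i → toℕ i < toℕ k → e i (fromℕ d) ≡ 0) →
                InInt (suc n) (contracted e k) × RemovalStep (mat (suc d) e) (toℕ k) (contracted e k)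
contract-step {d = zero}  Fin.zero A∈ valOne k≢d = contradiction refl k≢d
contract-step {d = suc d} k        A∈ valOne k≢d rowOnlyLast firstInLast =
  contract-InInt A∈ valOne k≢last rowOnlyLast firstInLast ,
  contract (contract-¬PosDiag A∈ valOne k≢last rowOnlyLast firstInLast) refl
           (≤∧≢⇒< (s≤s⁻¹ (toℕ<n k)) k≢d) (contract-index0-< A∈ valOne k≢last rowOnlyLast firstInLast)
  where
  k≢last : k ≢ fromℕ (suc d)
  k≢last k≡last = k≢d (trans (cong toℕ k≡last) (toℕ-fromℕ (suc d)))

decrement-step : ∀ {n d e} (k : Fin (suc d)) → InInt (suc (suc n)) (mat (suc d) e) → 0 < e k (fromℕ d) →
                 (k ≡ fromℕ d → 1 < e k (fromℕ d)) →
                 (∃ λ j → 0 < decr k (fromℕ d) e k j) → (∃ λ i → 0 < decr k (fromℕ d) e i (fromℕ d)) →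
                 (∀ i → toℕ i < toℕ k → e i (fromℕ d) ≡ 0) →
                 InInt (suc n) (mat (suc d) (decr k (fromℕ d) e)) ×
                 RemovalStep (mat (suc d) e) (toℕ k) (mat (suc d) (decr k (fromℕ d) e))
decrement-step {d = d} {e} k A∈ val-pos big rowk colLast firstInLast =
  decr-InInt k (fromℕ d) e A∈ val-pos rowk colLast ,
  decrement (decr-PosDiag k (fromℕ d) e big) refl (toℕ<n k) (decr-index0-≥ d e k firstInLast)

dropLast-step : ∀ {n d e} (k : Fin (suc d)) → InInt (suc (suc n)) (mat (suc d) e) →
                e k (fromℕ d) ≡ 1 → toℕ k ≡ d → (∀ i → toℕ i < toℕ k → e i (fromℕ d) ≡ 0) →
                InInt (suc n) (withoutLast e) × RemovalStep (mat (suc d) e) (toℕ k) (withoutLast e)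
dropLast-step {d = d} {e} k A∈ valOne k≡d firstInLast =
  dropLast-InInt A∈ lastOne aboveLast , dropLast (dropLast-PosDiag A∈ lastOne aboveLast) refl k≡d
  where
  k≡last : k ≡ fromℕ d
  k≡last = toℕ-injective (trans k≡d (sym (toℕ-fromℕ d)))
  lastOne : e (fromℕ d) (fromℕ d) ≡ 1
  lastOne = subst (λ z → e z (fromℕ d) ≡ 1) k≡last valOne
  aboveLast : ∀ i → e (inject₁ i) (fromℕ d) ≡ 0
  aboveLast i = firstInLast (inject₁ i) (subst (toℕ (inject₁ i) <_) (cong toℕ (sym k≡last)) (inject₁<fromℕ i))

removal-step : ∀ {n} A → InInt (suc (suc n)) A →
               InInt (suc n) (removal A) × RemovalStep A (lastVal (index0 A)) (removal A)
removal-step (mat zero e) A∈ with InInt.total A∈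
... | ()
removal-step (mat (suc d) e) A∈ with firstPos (suc d) (λ i → e i (fromℕ d)) in found
... | nothing = contradiction (firstPos-nothing (suc d) (λ i → e i (fromℕ d)) found (fromℕ d))
                              (n>0⇒n≢0 (lastDiagonal-pos A∈))
... | just k with firstPos-just (suc d) (λ i → e i (fromℕ d)) found
...   | val-pos , firstInLast with 1 <ᵇ e k (fromℕ d) | <ᵇ-reflects-< 1 (e k (fromℕ d))
...     | true | ofʸ val>1 = decrement-step k A∈ val-pos (λ _ → val>1) (c , still-pos) (k , still-pos) firstInLast
  where
  c : Fin (suc d)
  c = fromℕ d
  still-pos : 0 < decr k c e k c
  still-pos = subst (0 <_) (sym (decr-≡ k c e)) (∸-monoˡ-≤ 1 val>1)
...     | false | ofⁿ val≯1 with toℕ k ≡ᵇ d | ≡ᵇ-reflects-≡ (toℕ k) d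
...       | true | ofʸ k≡d = dropLast-step k A∈ (≤-antisym (≮⇒≥ val≯1) val-pos) k≡d firstInLast
...       | false | ofⁿ k≢d with anyFin (suc d) (λ j → not (does (j ≟ fromℕ d)) ∧ (0 <ᵇ e k j))
                                | anyFin-reflects (suc d) (λ j → not (does (j ≟ fromℕ d)) ∧ (0 <ᵇ e k j))
...         | true  | ofʸ (j , other) =
  decrement-step k A∈ val-pos (λ k≡c → contradiction k≡c k≢c) (j , row-pos) (c , column-pos) firstInLast
  where
  c : Fin (suc d)
  c = fromℕ d
  k≢c : k ≢ c
  k≢c k≡c = k≢d (trans (cong toℕ k≡c) (toℕ-fromℕ d))
  row-pos : 0 < decr k c e k j
  row-pos = let (j≢c , pos) = to (T-≢∧0< j c (e k j)) other in
            subst (0 <_) (sym (decr-≢ k c e k j (j≢c ∘ proj₂))) pos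
  column-pos : 0 < decr k c e c c
  column-pos = subst (0 <_) (sym (decr-≢ k c e c c (k≢c ∘ sym ∘ proj₁))) (lastDiagonal-pos A∈)
...         | false | ofⁿ none =
  contract-step k A∈ (≤-antisym (≮⇒≥ val≯1) val-pos) k≢d rowOnlyLast firstInLast
  where
  rowOnlyLast : ∀ j → j ≢ fromℕ d → e k j ≡ 0
  rowOnlyLast j j≢last =
    n≤0⇒n≡0 (≮⇒≥ (λ pos → none (j , from (T-≢∧0< j (fromℕ d) (e k j)) (j≢last , pos))))

RemovalStep-dim≤ : ∀ {A k B} → RemovalStep A k B → dim B ≤ dim A
RemovalStep-dim≤ (decrement _ dims _ _) = ≤-reflexive dims
RemovalStep-dim≤ (dropLast _ dims _)    = ≤-trans (n≤1+n _) (≤-reflexive dims)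
RemovalStep-dim≤ (contract _ dims _ _)  = ≤-trans (n≤1+n _) (≤-reflexive dims)

RemovalStep-value< : ∀ {A k B} → RemovalStep A k B → k < dim A
RemovalStep-value< (decrement _ dims k< _) = <-≤-trans k< (≤-reflexive dims)
RemovalStep-value< (dropLast _ dims refl)  = ≤-reflexive dims
RemovalStep-value< (contract _ dims k< _)  = <-≤-trans (m<n⇒m<1+n k<) (≤-reflexive dims)

-- Γ

record ΓInvariant (n : ℕ) (A : Mat) (x : List ℕ) : Set where
  field
    length≡    : length x ≡ suc n
    last≡index : nth x n ≡ lastVal (index0 A)
    bounded    : ∀ i → i ≤ n → nth x i < dim A
    reachesTop : PosDiag A → ∃ λ i → i ≤ n × suc (nth x i) ≡ dim A
    posDiag⇔   : PosDiag A ⇔ AscentsDominate n x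

ΓInvariant-snoc : ∀ {m A B xs k} → InInt (suc m) B → ΓInvariant m B xs → RemovalStep A k B →
                  k ≡ lastVal (index0 A) → ΓInvariant (suc m) A (xs ++ [ k ])
ΓInvariant-snoc {m} {A} {B} {xs} {k} B∈ inv step k≡index = record
  { length≡    = trans (length-++ xs) (trans (cong (_+ 1) length≡) (+-comm (suc m) 1))
  ; last≡index = trans new k≡index
  ; bounded    = bounded′
  ; reachesTop = reachesTop′ step
  ; posDiag⇔   = ⇔-trans (dominate⇔ step) (⇔-sym (AscentsDominate-snoc m xs k length≡))
  }
  where
  open ΓInvariant inv
  old : ∀ {i} → i ≤ m → nth (xs ++ [ k ]) i ≡ nth xs i
  old {i} i≤m = nth-++-< xs k i (subst (i <_) (sym length≡) (s≤s i≤m))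
  new : nth (xs ++ [ k ]) (suc m) ≡ k
  new = subst (λ j → nth (xs ++ [ k ]) j ≡ k) length≡ (nth-++-length xs k)
  indexB : ∃ λ l → index0 B ≡ just l
  indexB = index0-just B B∈
  last≡indexB : nth xs m ≡ proj₁ indexB
  last≡indexB = trans last≡index (cong lastVal (proj₂ indexB))

  bounded′ : ∀ i → i ≤ suc m → nth (xs ++ [ k ]) i < dim A
  bounded′ i i≤1+m with m≤n⇒m<n∨m≡n i≤1+m
  ... | inj₁ (s≤s i≤m) = subst (_< dim A) (sym (old i≤m)) (<-≤-trans (bounded i i≤m) (RemovalStep-dim≤ step))
  ... | inj₂ refl      = subst (_< dim A) (sym new) (RemovalStep-value< step)

  reachesTop′ : RemovalStep A k B → PosDiag A → ∃ λ i → i ≤ suc m × suc (nth (xs ++ [ k ]) i) ≡ dim A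
  reachesTop′ (decrement diag⇔ dims _ _) diag =
    let (i , i≤m , top) = reachesTop (to diag⇔ diag) in
    i , m≤n⇒m≤1+n i≤m , trans (cong suc (old i≤m)) (trans top dims)
  reachesTop′ (dropLast _ dims refl) _ = suc m , ≤-refl , trans (cong suc new) dims
  reachesTop′ (contract ¬diag _ _ _) diag = contradiction diag ¬diag

  dominate⇔ : RemovalStep A k B → PosDiag A ⇔ (AscentsDominate m xs × AscentDominates xs m k)
  dominate⇔ (decrement diag⇔ _ _ k≤indexB) =
    mk⇔ (λ diag → to posDiag⇔ (to diag⇔ diag) , noAscent) (from diag⇔ ∘ from posDiag⇔ ∘ proj₁)
    where
    noAscent : AscentDominates xs m k
    noAscent ascent = contradiction (subst (_< k) last≡indexB ascent) (≤⇒≯ (k≤indexB (proj₂ indexB)))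
  dominate⇔ (dropLast diag⇔ _ refl) =
    mk⇔ (λ diag → to posDiag⇔ (to diag⇔ diag) , λ _ q q<m → bounded q (<⇒≤ q<m))
        (from diag⇔ ∘ from posDiag⇔ ∘ proj₁)
  dominate⇔ (contract ¬diag _ k<dimB indexB<k) = mk⇔ (λ diag → contradiction diag ¬diag) impossible
    where
    -- B has a positive diagonal, so some entry of xs equals dim B - 1 ≥ k; but xs ends with an ascent to k.
    impossible : AscentsDominate m xs × AscentDominates xs m k → PosDiag A
    impossible (dominate , dominatesNew) with reachesTop (from posDiag⇔ dominate)
    ... | i , i≤m , top = case m≤n⇒m<n∨m≡n i≤m of λ
      { (inj₁ i<m) → contradiction (dominatesNew ascent i i<m) (≤⇒≯ k≤top)
      ; (inj₂ refl) → contradiction ascent (≤⇒≯ k≤top) }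
      where
      ascent : nth xs m < k
      ascent = subst (_< k) (sym last≡indexB) (indexB<k (proj₂ indexB))
      k≤top : k ≤ nth xs i
      k≤top = s≤s⁻¹ (subst (k <_) (sym top) k<dimB)

Γ-invariant : ∀ n A → InInt (suc n) A → ΓInvariant n A (Γ (suc n) A)
Γ-invariant zero (mat zero e) A∈ with InInt.total A∈
... | ()
Γ-invariant zero (mat (suc zero) e) A∈ = record
  { length≡    = refl
  ; last≡index = index-zero
  ; bounded    = λ { zero _ → z<s }
  ; reachesTop = λ _ → 0 , z≤n , refl
  ; posDiag⇔   = mk⇔ (λ _ p ()) (λ _ → λ { Fin.zero → lastDiagonal-pos A∈ })
  }
  where
  index-zero : 0 ≡ lastVal (index0 (mat 1 e))
  index-zero with 0 <ᵇ e Fin.zero Fin.zero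
  ... | true  = refl
  ... | false = refl
Γ-invariant zero (mat (suc (suc d)) e) A∈ = contradiction (dim≤total A∈) λ { (s≤s ()) }
Γ-invariant (suc m) A A∈ =
  let (B∈ , step) = removal-step A A∈ in ΓInvariant-snoc B∈ (Γ-invariant m (removal A) B∈) step refl

mainTheorem12 : (n : ℕ) → 1 ≤ n → (x : List ℕ) → InAsc n x →
                (A : Mat) → InInt n A → Γ n A ≡ x →
                ((∀ (i : Fin (dim A)) → 0 < entry A i i) ⇔ hat x ≡ x)
mainTheorem12 (suc n) _ x _ A A∈ refl =
  ⇔-trans posDiag⇔ (⇔-sym (subst (λ m → hat x ≡ x ⇔ AscentsDominate m x) length-1≡n (hat-fixed x)))
  where
  open ΓInvariant (Γ-invariant n A A∈)
  length-1≡n : length x ∸ 1 ≡ n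
  length-1≡n = cong (_∸ 1) length≡
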